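{- Let $k,n$ be positive integers and $G\subseteq S_k$ a subgroup. The poset $(B_{\mathbf{1}_G}(k,n),\preccurlyeq)$ is graded with rank function $\rho(x)=\sum_{i=1}^k(x_i-1)$.
   Context: $S_k$ acts on $[n]^k$ by $w(x)=(x_{w^{ -1}(1)},\dots,x_{w^{ -1}(k)})$. For $x\in[n]^k$, $\overline{x}$ is the lexicographic minimum of $\{g(x):g\in G\}$. $B_{\mathbf{1}_G}(k,n)=\{\overline x:x\in[n]^k\}$ with $x\preccurlyeq y$ iff $x\leqslant g(y)$ componentwise for some $g\in G$. -}

module Defs where

open import Data.Nat using (ℕ; zero; suc; _+_; _∸_; _≤_; _<_)
open import Data.Fin using (Fin; zero; suc)
open import Data.Fin.Permutation using (Permutation′; _⟨$⟩ʳ_; _⟨$⟩ˡ_; id; flip; _∘ₚ_)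
open import Data.Product using (Σ; _×_; ∃; ∃-syntax; _,_)
open import Data.Sum using (_⊎_)
open import Data.Unit using (⊤)
open import Relation.Binary.PropositionalEquality using (_≡_)
open import Relation.Nullary using (¬_)

record Subgroup (k : ℕ) : Set₁ where
  field
    _∈G     : Permutation′ k → Set
    id∈     : id ∈G
    comp∈   : ∀ {g h} → g ∈G → h ∈G → (g ∘ₚ h) ∈G
    inv∈    : ∀ {g} → g ∈G → flip g ∈G
open Subgroup public

Word : ℕ → Set
Word k = Fin k → ℕ

InBox : (k n : ℕ) → Word k → Set
InBox k n x = ∀ i → 1 ≤ x i × x i ≤ n

-- the action w(x) = (x_{w⁻¹(1)}, …, x_{w⁻¹(k)})
act : ∀ {k} → Permutation′ k → Word k → Word k
act w x i = x (w ⟨$⟩ˡ i)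

_≤lex_ : ∀ {k} → Word k → Word k → Set
_≤lex_ {zero}  x y = ⊤
_≤lex_ {suc k} x y =
  (x zero < y zero) ⊎ ((x zero ≡ y zero) × ((λ i → x (suc i)) ≤lex (λ i → y (suc i))))

IsLexMinOfOrbit : ∀ {k} → Subgroup k → Word k → Word k → Set
IsLexMinOfOrbit G x y =
  (∃[ g ] ((G ∈G) g × (∀ i → x i ≡ act g y i))) ×
  (∀ g → (G ∈G) g → x ≤lex act g y)

InB : ∀ {k} → Subgroup k → ℕ → Word k → Set
InB {k} G n x = ∃[ y ] (InBox k n y × IsLexMinOfOrbit G x y)

_⊢_≼_ : ∀ {k} → Subgroup k → Word k → Word k → Set
G ⊢ x ≼ y = ∃[ g ] ((G ∈G) g × (∀ i → x i ≤ act g y i))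

_⊢_≺_ : ∀ {k} → Subgroup k → Word k → Word k → Set
G ⊢ x ≺ y = (G ⊢ x ≼ y) × ¬ (∀ i → x i ≡ y i)

Covers : ∀ {k} → Subgroup k → ℕ → Word k → Word k → Set
Covers G n x y = (G ⊢ x ≺ y) × (¬ (∃[ z ] (InB G n z × (G ⊢ x ≺ z) × (G ⊢ z ≺ y))))

Minimal : ∀ {k} → Subgroup k → ℕ → Word k → Set
Minimal G n x = ¬ (∃[ z ] (InB G n z × (G ⊢ z ≺ x)))

sumFin : ∀ {k} → (Fin k → ℕ) → ℕ
sumFin {zero}  f = 0
sumFin {suc k} f = f zero + sumFin (λ i → f (suc i))

rank : ∀ {k} → Word k → ℕ
rank x = sumFin (λ i → x i ∸ 1)

IsGradedBy : ∀ {k} → Subgroup k → ℕ → (Word k → ℕ) → Set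
IsGradedBy G n r =
  (∀ x → InB G n x → Minimal G n x → r x ≡ 0) ×
  (∀ x y → InB G n x → InB G n y → Covers G n x y → r y ≡ suc (r x))

-- The all-ones word lies in B and below every element, so minimal elements
-- have rank 0.  If y covers x, then x ≤ g(y) componentwise with strict
-- inequality in some coordinate j (otherwise x and y would be lexicographic
-- minima of the same orbit, hence equal).  Raising x_j by one gives a word z
-- in [n]^k with x ≤ z ≤ g(y); its orbit minimum z̄ lies in B with
-- x ≼ z̄ ≼ y and ρ(z̄) = ρ(x) + 1, so the cover forces z̄ = y.
module Submission where

open import Defs
open import Data.Nat using (ℕ; zero; suc; _+_; _∸_; _≤_; _<_; _≟_)
open import Data.Nat.Properties
open import Data.Nat.Induction using (<-wellFounded)
open import Data.Fin using (Fin; zero; suc)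
open import Data.Fin.Properties using (¬∀⟶∃¬)
open import Data.Fin.Permutation using (Permutation′; _⟨$⟩ʳ_; _⟨$⟩ˡ_; id; flip; _∘ₚ_; inverseˡ)
open import Data.Vec.Functional using (tail; map; updateAt)
open import Data.Product using (∃-syntax; _×_; _,_; proj₁; proj₂)
open import Data.Product.Relation.Binary.Lex.Strict using (×-wellFounded)
open import Data.Sum using (_⊎_; inj₁; inj₂)
open import Data.Unit using (tt)
open import Data.Empty using (⊥)
open import Function using (_∘_)
open import Induction.WellFounded using (WellFounded; Acc; acc)
import Relation.Binary.Construct.On as On
open import Relation.Binary.PropositionalEquality
open import Relation.Binary.Definitions using (tri<; tri≈; tri>)
open import Relation.Nullary using (¬_; contradiction)
open import Relation.Nullary.Decidable using (decidable-stable)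
import Algebra.Properties.CommutativeMonoid.Sum as CommutativeMonoidSum

open CommutativeMonoidSum +-0-commutativeMonoid using (sum; sum-cong-≗; sum-permute)

sumFin≡sum : ∀ {k} (f : Fin k → ℕ) → sumFin f ≡ sum f
sumFin≡sum {zero}  f = refl
sumFin≡sum {suc k} f = cong (f zero +_) (sumFin≡sum (tail f))

sumFin-updateAt-suc : ∀ {k} (f : Fin k → ℕ) (j : Fin k) →
  sumFin (updateAt f j suc) ≡ suc (sumFin f)
sumFin-updateAt-suc f zero    = refl
sumFin-updateAt-suc f (suc j) =
  trans (cong (f zero +_) (sumFin-updateAt-suc (tail f) j)) (+-suc (f zero) _)

map-updateAt-local : ∀ {A : Set} {k} (f g h : A → A) (xs : Fin k → A) (j : Fin k) →
  f (g (xs j)) ≡ h (f (xs j)) → map f (updateAt xs j g) ≗ updateAt (map f xs) j h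
map-updateAt-local f g h xs zero    eq zero    = eq
map-updateAt-local f g h xs zero    eq (suc i) = refl
map-updateAt-local f g h xs (suc j) eq zero    = refl
map-updateAt-local f g h xs (suc j) eq (suc i) = map-updateAt-local f g h (tail xs) j eq i

rank-cong : ∀ {k} {x y : Word k} → x ≗ y → rank x ≡ rank y
rank-cong {x = x} {y} x≗y = begin
  rank x                  ≡⟨ sumFin≡sum (λ i → x i ∸ 1) ⟩
  sum (λ i → x i ∸ 1)     ≡⟨ sum-cong-≗ (cong (_∸ 1) ∘ x≗y) ⟩
  sum (λ i → y i ∸ 1)     ≡⟨ sumFin≡sum (λ i → y i ∸ 1) ⟨
  rank y                  ∎
  where open ≡-Reasoning

rank-act : ∀ {k} (g : Permutation′ k) (x : Word k) → rank (act g x) ≡ rank x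
rank-act g x = begin
  rank (act g x)                  ≡⟨ sumFin≡sum (λ i → x (g ⟨$⟩ˡ i) ∸ 1) ⟩
  sum (λ i → x (g ⟨$⟩ˡ i) ∸ 1)    ≡⟨ sum-permute (λ i → x i ∸ 1) (flip g) ⟨
  sum (λ i → x i ∸ 1)             ≡⟨ sumFin≡sum (λ i → x i ∸ 1) ⟨
  rank x                          ∎
  where open ≡-Reasoning

rank-updateAt-suc : ∀ {k} (x : Word k) (j : Fin k) → 1 ≤ x j →
  rank (updateAt x j suc) ≡ suc (rank x)
rank-updateAt-suc x j 1≤xj = begin
  rank (updateAt x j suc)                   ≡⟨ sumFin≡sum (map (_∸ 1) (updateAt x j suc)) ⟩
  sum (map (_∸ 1) (updateAt x j suc))
    ≡⟨ sum-cong-≗ (map-updateAt-local (_∸ 1) suc suc x j (+-∸-assoc 1 1≤xj)) ⟩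
  sum (updateAt (map (_∸ 1) x) j suc)       ≡⟨ sumFin≡sum (updateAt (map (_∸ 1) x) j suc) ⟨
  sumFin (updateAt (map (_∸ 1) x) j suc)    ≡⟨ sumFin-updateAt-suc (map (_∸ 1) x) j ⟩
  suc (rank x)                              ∎
  where open ≡-Reasoning

rank-ones : ∀ {k} → rank {k} (λ _ → 1) ≡ 0
rank-ones {zero}  = refl
rank-ones {suc k} = rank-ones {k}

≤-updateAt-suc : ∀ {k} (x : Word k) (j : Fin k) → ∀ i → x i ≤ updateAt x j suc i
≤-updateAt-suc x zero    zero    = n≤1+n (x zero)
≤-updateAt-suc x zero    (suc i) = ≤-refl
≤-updateAt-suc x (suc j) zero    = ≤-refl
≤-updateAt-suc x (suc j) (suc i) = ≤-updateAt-suc (tail x) j i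

updateAt-suc-≤ : ∀ {k} {x y : Word k} (j : Fin k) → (∀ i → x i ≤ y i) → x j < y j →
  ∀ i → updateAt x j suc i ≤ y i
updateAt-suc-≤ zero    x≤y xj<yj zero    = xj<yj
updateAt-suc-≤ zero    x≤y xj<yj (suc i) = x≤y (suc i)
updateAt-suc-≤ (suc j) x≤y xj<yj zero    = x≤y zero
updateAt-suc-≤ (suc j) x≤y xj<yj (suc i) = updateAt-suc-≤ j (x≤y ∘ suc) xj<yj i

≤∧≉⇒∃< : ∀ {k} {x y : Word k} → (∀ i → x i ≤ y i) → ¬ x ≗ y → ∃[ j ] x j < y j
≤∧≉⇒∃< {k} {x} {y} x≤y x≉y with ¬∀⟶∃¬ k (λ i → x i ≡ y i) (λ i → x i ≟ y i) x≉y
... | j , xj≢yj = j , ≤∧≢⇒< (x≤y j) xj≢yj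

_<lex_ : ∀ {k} → Word k → Word k → Set
_<lex_ {zero}  x y = ⊥
_<lex_ {suc k} x y = (x zero < y zero) ⊎ ((x zero ≡ y zero) × (tail x <lex tail y))

<lex-wellFounded : ∀ {k} → WellFounded (_<lex_ {k})
<lex-wellFounded {zero}  x = acc λ ()
<lex-wellFounded {suc k} =
  On.wellFounded (λ x → x zero , tail x) (×-wellFounded <-wellFounded <lex-wellFounded)

≤lex-refl : ∀ {k} (x : Word k) → x ≤lex x
≤lex-refl {zero}  x = tt
≤lex-refl {suc k} x = inj₂ (refl , ≤lex-refl (tail x))

≤lex-respects-≗ : ∀ {k} {x x′ y y′ : Word k} → x ≗ x′ → y ≗ y′ → x ≤lex y → x′ ≤lex y′
≤lex-respects-≗ {zero}  _  _  _ = tt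
≤lex-respects-≗ {suc k} ex ey (inj₁ x<y) = inj₁ (subst₂ _<_ (ex zero) (ey zero) x<y)
≤lex-respects-≗ {suc k} ex ey (inj₂ (x≡y , tx≤ty)) =
  inj₂ (trans (sym (ex zero)) (trans x≡y (ey zero)) , ≤lex-respects-≗ (ex ∘ suc) (ey ∘ suc) tx≤ty)

≤lex-antisym : ∀ {k} {x y : Word k} → x ≤lex y → y ≤lex x → x ≗ y
≤lex-antisym {suc k} (inj₁ x<y)        (inj₁ y<x)        _       = contradiction y<x (<-asym x<y)
≤lex-antisym {suc k} (inj₁ x<y)        (inj₂ (y≡x , _))  _       = contradiction x<y (<-irrefl (sym y≡x))
≤lex-antisym {suc k} (inj₂ (x≡y , _))  (inj₁ y<x)        _       = contradiction y<x (<-irrefl (sym x≡y))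
≤lex-antisym {suc k} (inj₂ (x≡y , _))  (inj₂ _)          zero    = x≡y
≤lex-antisym {suc k} (inj₂ (_ , tx≤ty)) (inj₂ (_ , ty≤tx)) (suc i) = ≤lex-antisym tx≤ty ty≤tx i

≤lex-or->lex : ∀ {k} (x y : Word k) → x ≤lex y ⊎ y <lex x
≤lex-or->lex {zero}  x y = inj₁ tt
≤lex-or->lex {suc k} x y with <-cmp (x zero) (y zero) | ≤lex-or->lex (tail x) (tail y)
... | tri< x<y _ _   | _            = inj₁ (inj₁ x<y)
... | tri> _ _ y<x   | _            = inj₂ (inj₁ y<x)
... | tri≈ _ x≡y _   | inj₁ tx≤ty   = inj₁ (inj₂ (x≡y , tx≤ty))
... | tri≈ _ x≡y _   | inj₂ ty<tx   = inj₂ (inj₂ (sym x≡y , ty<tx))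

-- Membership in G is not decidable, so a lexicographic minimum only exists
-- up to double negation.
¬¬-<lex-minimal : ∀ {k} (Q : Word k → Set) {a : Word k} → Q a →
  ¬ ¬ (∃[ m ] (Q m × (∀ w → Q w → ¬ (w <lex m))))
¬¬-<lex-minimal Q {a} qa ¬min = go a (<lex-wellFounded a) qa
  where
  go : ∀ a → Acc _<lex_ a → ¬ Q a
  go a (acc rec) qa = ¬min (a , qa , λ w qw w<a → go w (rec w<a) qw)

_⊢_∼_ : ∀ {k} → Subgroup k → Word k → Word k → Set
G ⊢ x ∼ y = ∃[ g ] ((G ∈G) g × (x ≗ act g y))

module _ {k} (G : Subgroup k) where

  ∼-sym : ∀ {x y} → G ⊢ x ∼ y → G ⊢ y ∼ x
  ∼-sym {x} {y} (g , g∈ , x≗gy) =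
    flip g , inv∈ G g∈ , λ i → sym (trans (x≗gy (g ⟨$⟩ʳ i)) (cong y (inverseˡ g)))

  ∼-trans : ∀ {x y z} → G ⊢ x ∼ y → G ⊢ y ∼ z → G ⊢ x ∼ z
  ∼-trans (g , g∈ , x≗gy) (h , h∈ , y≗hz) =
    h ∘ₚ g , comp∈ G h∈ g∈ , λ i → trans (x≗gy i) (y≗hz (g ⟨$⟩ˡ i))

  ≼-trans : ∀ {x y z} → G ⊢ x ≼ y → G ⊢ y ≼ z → G ⊢ x ≼ z
  ≼-trans (g , g∈ , x≤gy) (h , h∈ , y≤hz) =
    h ∘ₚ g , comp∈ G h∈ g∈ , λ i → ≤-trans (x≤gy i) (y≤hz (g ⟨$⟩ˡ i))

  ≤⇒≼ : ∀ {x y} → (∀ i → x i ≤ y i) → G ⊢ x ≼ y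
  ≤⇒≼ x≤y = id , id∈ G , x≤y

  ∼⇒≼ : ∀ {x y} → G ⊢ x ∼ y → G ⊢ x ≼ y
  ∼⇒≼ (g , g∈ , x≗gy) = g , g∈ , ≤-reflexive ∘ x≗gy

  lexMin-≤lex : ∀ {x u w} → IsLexMinOfOrbit G x u → G ⊢ w ∼ u → x ≤lex w
  lexMin-≤lex (_ , x≤lex) (g , g∈ , w≗gu) = ≤lex-respects-≗ (λ _ → refl) (sym ∘ w≗gu) (x≤lex g g∈)

  lexMin-unique : ∀ {x y u v} → IsLexMinOfOrbit G x u → IsLexMinOfOrbit G y v →
    G ⊢ x ∼ y → x ≗ y
  lexMin-unique {x} {y} {u} {v} x-min@(x∼u , _) y-min@(y∼v , _) x∼y = ≤lex-antisym
    (lexMin-≤lex {x} {u} {y} x-min (∼-trans {y} {x} {u} (∼-sym {x} {y} x∼y) x∼u))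
    (lexMin-≤lex {y} {v} {x} y-min (∼-trans {x} {y} {v} x∼y y∼v))

  ¬¬-lexMinOfOrbit : ∀ z → ¬ ¬ (∃[ m ] IsLexMinOfOrbit G m z)
  ¬¬-lexMinOfOrbit z ¬lexMin =
    ¬¬-<lex-minimal (G ⊢_∼ z) (id , id∈ G , λ _ → refl) λ (m , m∼z , m-min) →
      ¬lexMin (m , m∼z , λ g g∈ → ≤lex-of-¬>lex m-min g g∈)
    where
    ≤lex-of-¬>lex : ∀ {m} → (∀ w → G ⊢ w ∼ z → ¬ (w <lex m)) →
      ∀ g → (G ∈G) g → m ≤lex act g z
    ≤lex-of-¬>lex {m} m-min g g∈ with ≤lex-or->lex m (act g z)
    ... | inj₁ m≤gz = m≤gz
    ... | inj₂ gz<m = contradiction gz<m (m-min (act g z) (g , g∈ , λ _ → refl))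

  rank-∼ : ∀ {x y} → G ⊢ x ∼ y → rank x ≡ rank y
  rank-∼ {y = y} (g , _ , x≗gy) = trans (rank-cong x≗gy) (rank-act g y)

module _ {k} (G : Subgroup k) (n : ℕ) where

  InB⇒InBox : ∀ {x} → InB G n x → InBox k n x
  InB⇒InBox {x} (y , y∈box , (g , _ , x≗gy) , _) i =
    subst (λ v → 1 ≤ v × v ≤ n) (sym (x≗gy i)) (y∈box (g ⟨$⟩ˡ i))

  InB-unique : ∀ {x y} → InB G n x → InB G n y → G ⊢ x ∼ y → x ≗ y
  InB-unique {x} {y} (u , _ , x-min) (v , _ , y-min) = lexMin-unique G {x} {y} {u} {v} x-min y-min

  minimal⇒rank≡0 : 1 ≤ n → ∀ x → InB G n x → Minimal G n x → rank x ≡ 0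
  minimal⇒rank≡0 1≤n x x∈B x-minimal = decidable-stable (rank x ≟ 0) λ rank≢0 →
    x-minimal (ones , ones∈B , ≤⇒≼ G (proj₁ ∘ InB⇒InBox x∈B) ,
               λ ones≗x → rank≢0 (trans (sym (rank-cong ones≗x)) (rank-ones {k})))
    where
    ones : Word k
    ones _ = 1
    ones∈B : InB G n ones
    ones∈B = ones , (λ _ → ≤-refl , 1≤n) , (id , id∈ G , λ _ → refl) , λ _ _ → ≤lex-refl ones

  raise-between : ∀ {x y} → InB G n x → InB G n y → G ⊢ x ≺ y →
    ¬ ¬ (∃[ m ] (InB G n m × G ⊢ x ≼ m × G ⊢ m ≼ y × rank m ≡ suc (rank x)))
  raise-between {x} {y} x∈B y∈B ((g , g∈ , x≤gy) , x≉y) =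
    raise-at (≤∧≉⇒∃< x≤gy λ x≗gy → x≉y (InB-unique x∈B y∈B (g , g∈ , x≗gy)))
    where
    1≤x : ∀ i → 1 ≤ x i
    1≤x = proj₁ ∘ InB⇒InBox x∈B
    y≤n : ∀ i → y i ≤ n
    y≤n = proj₂ ∘ InB⇒InBox y∈B
    raise-at : ∃[ j ] x j < act g y j →
      ¬ ¬ (∃[ m ] (InB G n m × G ⊢ x ≼ m × G ⊢ m ≼ y × rank m ≡ suc (rank x)))
    raise-at (j , xj<gyj) ¬between =
      ¬¬-lexMinOfOrbit G z λ (m , m-min@(m∼z , _)) → ¬between
        ( m , (z , z∈box , m-min)
        , ≼-trans G {x} {z} {m} (≤⇒≼ G (≤-updateAt-suc x j)) (∼⇒≼ G {z} {m} (∼-sym G {m} {z} m∼z))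
        , ≼-trans G {m} {z} {y} (∼⇒≼ G {m} {z} m∼z) (g , g∈ , z≤gy)
        , trans (rank-∼ G {m} {z} m∼z) (rank-updateAt-suc x j (1≤x j)))
      where
      z : Word k
      z = updateAt x j suc
      z≤gy : ∀ i → z i ≤ act g y i
      z≤gy = updateAt-suc-≤ j x≤gy xj<gyj
      z∈box : InBox k n z
      z∈box i = ≤-trans (1≤x i) (≤-updateAt-suc x j i) , ≤-trans (z≤gy i) (y≤n (g ⟨$⟩ˡ i))

  covers⇒rank-suc : ∀ x y → InB G n x → InB G n y → Covers G n x y → rank y ≡ suc (rank x)
  covers⇒rank-suc x y x∈B y∈B (x≺y , nothing-between) =
    decidable-stable (rank y ≟ suc (rank x)) λ rank-y≢ →
      raise-between x∈B y∈B x≺y λ (m , m∈B , x≼m , m≼y , rank-m) → nothing-between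
        ( m , m∈B
        , (x≼m , λ x≗m → 1+n≢n (sym (trans (rank-cong x≗m) rank-m)))
        , (m≼y , λ m≗y → rank-y≢ (trans (sym (rank-cong m≗y)) rank-m)))

proposition5p5 : (k n : ℕ) → 1 ≤ k → 1 ≤ n → (G : Subgroup k) →
    IsGradedBy G n rank
proposition5p5 k n _ 1≤n G = minimal⇒rank≡0 G n 1≤n , covers⇒rank-suc G n
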